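{- On the graph $\overline{\mathcal{DS}}(n)$, let $a = (p,\ell)$ and $b = (q,\ell)$ be two distinct points on the lattice line $y = \ell$. Let $a^{\prime} = (p+1,\ell-1)$ and $b^{\prime} = (q+1,\ell-1)$ be the points obtained from $a$ and $b$ by shifting downward one lattice line, and assume that $a^{\prime}$ and $b^{\prime}$ are still contained in $\overline{\mathcal{DS}}(n)$. Then $$Q_{V^{*}}(a,b) = Q_{V^{*}}(a^{\prime},b^{\prime}).$$
   Context: Setting: Let $AD(n)$ be the Aztec diamond of order $n$ (the union of unit squares in $|x|+|y|\le n+1$), with the checkerboard coloring in which the unit squares along its top right side are black. Mark the midpoint of the left edge of each black unit square and join these midpoints by edges; this gives a subgraph of the triangular lattice. Coordinates on the triangular lattice: the positive $x$-axis is a lattice line pointing southeast and the positive $y$-axis a lattice line pointing northeast; edges parallel to the $x$-axis are oriented southeast, those parallel to the $y$-axis northeast, and those parallel to $y=x$ east (so paths use steps $(1,0),(0,1),(1,1)$, i.e. Delannoy paths). Let $\mathcal{DS}(n)$ be the "left half" of this graph (the part on or to the left of the vertical diagonal of $AD(n)$). Label the midpoints on the vertical diagonal by $v_2,v_4,\dots,v_{2n}$ from bottom to top and the midpoints one unit to the left of the vertical diagonal by $v_1,v_3,\dots,v_{2n-1}$ from bottom to top, and set $V=\{v_1,\dots,v_{2n}\}$. The graph $\overline{\mathcal{DS}}(n)$ is obtained from $\mathcal{DS}(n)$ by adding edges (oriented southeast) between consecutive points on its southwestern boundary. All edge weights are $1$. For vertices $a,b$, write $N(a,v)$ for the number of directed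 paths from $a$ to $v$ in $\overline{\mathcal{DS}}(n)$, and define $$Q_{V^{*}}(a,b)=\sum_{1\le m\le n}\det\begin{bmatrix} N(a,v_{2m-1}) & N(a,v_{2m})\\ N(b,v_{2m-1}) & N(b,v_{2m})\end{bmatrix},$$ which counts pairs of non-intersecting paths starting at $a$ and $b$ whose two ending points are $\{v_{2m-1},v_{2m}\}$ for some $m$. -}

module Defs where

open import Data.Bool using (Bool; true; false; _∧_; _∨_; if_then_else_)
open import Data.Nat as ℕ using (ℕ; zero; suc; _%_)
open import Data.Integer as ℤ using (ℤ; +_; -_; _+_; _-_; _*_; ∣_∣; 1ℤ; 0ℤ)
open import Data.Product using (_×_; _,_; proj₁; proj₂)
open import Data.List using (List; []; _∷_; map)
open import Data.Nat.ListAction using (sum)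
open import Relation.Binary.PropositionalEquality using (_≡_)
open import Relation.Nullary.Decidable using (⌊_⌋)

-- Unit squares of the plane.  The pair (i , j) denotes the closed unit
-- square [i , i+1] × [j , j+1].

Square : Set
Square = ℤ × ℤ

-- The Aztec diamond AD(n): the union of the unit squares contained in
-- the region |X| + |Y| ≤ n + 1.  A unit square is contained in this
-- (convex) region iff its four corners are.
cornerIn : ℕ → ℤ → ℤ → Bool
cornerIn n X Y = (∣ X ∣ ℕ.+ ∣ Y ∣) ℕ.≤ᵇ suc n

inAD : ℕ → Square → Bool
inAD n (i , j) =
  cornerIn n i j ∧ cornerIn n (i + 1ℤ) j ∧
  cornerIn n i (j + 1ℤ) ∧ cornerIn n (i + 1ℤ) (j + 1ℤ)

-- Checkerboard colouring of AD(n) in which the squares along the top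
-- right side (the squares (i , j) with i , j ≥ 0 and i + j = n - 1) are
-- black:  (i , j) is black iff i + j ≡ n - 1 (mod 2).
black : ℕ → Square → Bool
black n (i , j) = (∣ i + j + + suc n ∣ % 2) ℕ.≡ᵇ 0

-- The midpoint of the left edge of the square (i , j) is the plane point
-- (i , j + 1/2).  Lattice coordinates (x , y): the positive x-axis points
-- southeast (plane vector (1 , -1)), the positive y-axis points northeast
-- (plane vector (1 , 1)), so the direction of y = x is east (plane
-- vector (2 , 0)).  We put the origin at v₁ (the left-edge midpoint of
-- the bottom black square (-1 , -n) one unit left of the vertical
-- diagonal); the statement is translation invariant, so the choice of
-- origin is immaterial.  Hence the lattice point (x , y) is the
-- left-edge midpoint of the square (x + y - 1 , y - x - n).

Pt : Set
Pt = ℤ × ℤ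

sq : ℕ → Pt → Square
sq n (x , y) = (x + y - 1ℤ , y - x - + n)

_==_ : Pt → Pt → Bool
(x , y) == (x' , y') = ⌊ x ℤ.≟ x' ⌋ ∧ ⌊ y ℤ.≟ y' ⌋

isVertexAD : ℕ → Pt → Bool
isVertexAD n u = inAD n (sq n u) ∧ black n (sq n u)

-- vertices of DS(n): those on or to the left of the vertical diagonal
-- (the plane line X = 0); the midpoint of the left edge of (i , j) has
-- plane abscissa i.
isDS : ℕ → Pt → Bool
isDS n u = isVertexAD n u ∧ (proj₁ (sq n u) ℤ.≤ᵇ 0ℤ)

InDS : ℕ → Pt → Set
InDS n u = isDS n u ≡ true

data Step : Set where
  se ne e : Step

steps : List Step
steps = se ∷ ne ∷ e ∷ []

move : Step → Pt → Pt
move se (x , y) = (x + 1ℤ , y)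
move ne (x , y) = (x , y + 1ℤ)
move e  (x , y) = (x + 1ℤ , y + 1ℤ)

-- The segment joining the left-edge midpoint of the square (i , j) to a
-- neighbouring midpoint crosses (besides (i , j) itself) one further
-- unit square; the edge belongs to the graph drawn inside AD(n) iff the
-- segment stays inside AD(n), i.e. iff this square belongs to AD(n).
crossed : Step → Square → Square
crossed se (i , j) = (i , j - 1ℤ)
crossed ne (i , j) = (i , j + 1ℤ)
crossed e  (i , j) = (i + 1ℤ , j)

edgeDS : ℕ → Step → Pt → Bool
edgeDS n s u = isDS n u ∧ isDS n (move s u) ∧ inAD n (crossed s (sq n u))

onSW : ℕ → Pt → Bool
onSW n u = ⌊ (proj₁ (sq n u) + proj₂ (sq n u)) ℤ.≟ - + suc n ⌋

extraSW : ℕ → Step → Pt → Bool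
extraSW n se u = isDS n u ∧ isDS n (move se u) ∧ onSW n u ∧ onSW n (move se u)
extraSW n ne u = false
extraSW n e  u = false

edge : ℕ → Step → Pt → Bool
edge n s u = edgeDS n s u ∨ extraSW n s u

-- Every step raises x + y by at least 1,
-- and on DS‾(n) the quantity x + y ranges over an interval of length
-- < 2n, so every directed path has length < 2n.  countPaths n k a v is
-- the number of directed paths from a to v with at most k steps
-- (recursion on the first step); with k = 2n this is the number of all
-- directed paths from a to v.

countPaths : ℕ → ℕ → Pt → Pt → ℕ
countPaths n zero    a v = if a == v then 1 else 0
countPaths n (suc k) a v =
  (if a == v then 1 else 0) +ₙ
  sum (map (λ s → if edge n s a then countPaths n k (move s a) v else 0) steps)
  where _+ₙ_ = ℕ._+_

N : ℕ → Pt → Pt → ℕ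
N n a v = countPaths n (2 ℕ.* n) a v

-- For 1 ≤ m ≤ n:
--   v₂ₘ₋₁ = left-edge midpoint of the square (-1 , -n + 2(m-1))
--           (one unit left of the vertical diagonal), lattice point
--           (-(m-1) , m-1);
--   v₂ₘ   = left-edge midpoint of the square (0 , -n + 2m - 1)
--           (on the vertical diagonal), lattice point (1-m , m).
vOdd : ℕ → Pt
vOdd m = (- (+ m - 1ℤ) , + m - 1ℤ)

vEven : ℕ → Pt
vEven m = (1ℤ - + m , + m)

det2 : ℕ → Pt → Pt → ℕ → ℤ
det2 n a b m = + N n a (vOdd m) * + N n b (vEven m) - + N n a (vEven m) * + N n b (vOdd m)

sumTo : ℕ → (ℕ → ℤ) → ℤ
sumTo zero    f = 0ℤ
sumTo (suc k) f = sumTo k f + f (suc k)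

QV : ℕ → Pt → Pt → ℤ
QV n a b = sumTo n (det2 n a b)

-- In lattice coordinates DS(n) is the set of (x , y) with 0 ≤ y, 1 - n ≤ x ≤ 0 and
-- x + y ≤ 1, and the barred graph has every Delannoy step between two of its points:
-- the added southwestern edges supply exactly the southeast steps along y = 0 that
-- leave the diamond.  Since this region is order-convex, a Delannoy path between two
-- of its points never leaves it, so N(u , v) is the free Delannoy count of the
-- displacement v - u.  Shifting a and b one line down shifts every displacement to
-- the next pair (v₂ₘ₋₁ , v₂ₘ), so Q(a′ , b′) is the sum for Q(a , b) with its index
-- moved by one; the two boundary terms vanish because no path from a or b reaches
-- v₁ (it lies below them) or the point v₂ₙ₊₁ beyond the diamond (left of them).
module Submission where

open import Defs
open import Data.Bool using (Bool; true; false; _∧_; _∨_; if_then_else_)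
open import Data.Bool.Properties using (T-≡; ∨-zeroʳ)
open import Data.Integer using (ℤ; +_; -[1+_]; -_; _+_; _-_; _*_; 0ℤ; 1ℤ; -1ℤ; ∣_∣; _≤_; _≟_; +≤+)
import Data.Integer.Properties as ℤP
open import Data.Integer.Tactic.RingSolver using (solve)
open import Data.List using (_∷_; []; map)
open import Data.List.Properties using (map-cong)
open import Data.Nat as ℕ using (ℕ; zero; suc; z≤n; s≤s)
import Data.Nat.DivMod as ℕD
open import Data.Nat.ListAction using (sum)
import Data.Nat.Properties as ℕP
open import Data.Product using (_×_; _,_; proj₁; proj₂)
open import Data.Sum using (_⊎_; inj₁; inj₂)
open import Function.Base using (_∘_)
open import Function.Bundles using (Equivalence; _⇔_; mk⇔)
open import Relation.Binary.PropositionalEquality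
  using (_≡_; _≢_; refl; sym; trans; cong; cong₂; module ≡-Reasoning)
open import Relation.Nullary using (¬_; yes; no; does; contradiction)
open import Relation.Nullary.Decidable using (⌊_⌋; isYes≗does; does-⇔; dec-true)

-- Linear inequalities are proved as a sum of known nonnegative terms, rewritten by a
-- ring identity.  Since solve abstracts only variables, such lemmas are stated for an
-- integer M (or N) standing for + n.
infixl 6 _⊕_
infix 2 _by_

_⊕_ : ∀ {i j} → 0ℤ ≤ i → 0ℤ ≤ j → 0ℤ ≤ i + j
_⊕_ = ℤP.+-mono-≤

_by_ : ∀ {i j} → 0ℤ ≤ i → i ≡ j → 0ℤ ≤ j
p by refl = p

0≤+ : ∀ k → 0ℤ ≤ + k
0≤+ k = +≤+ z≤n

0≰-1 : ¬ (0ℤ ≤ -1ℤ)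
0≰-1 ()

0≤i-1⇒0≤i : ∀ i → 0ℤ ≤ i - 1ℤ → 0ℤ ≤ i
0≤i-1⇒0≤i i 1≤i = 1≤i ⊕ 0≤+ 1 by solve (i ∷ [])

j-[i+1]≡j-i-1 : ∀ i j → j - (i + 1ℤ) ≡ j - i - 1ℤ
j-[i+1]≡j-i-1 i j = solve (i ∷ j ∷ [])

[j+k]-[i+k]≡j-i : ∀ i j k → (j + k) - (i + k) ≡ j - i
[j+k]-[i+k]≡j-i i j k = solve (i ∷ j ∷ k ∷ [])

0≤i+i⇒0≤i : ∀ i → 0ℤ ≤ i + i → 0ℤ ≤ i
0≤i+i⇒0≤i (+ k) _ = 0≤+ k

0≤i+i+1⇒0≤i : ∀ i → 0ℤ ≤ i + i + 1ℤ → 0ℤ ≤ i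
0≤i+i+1⇒0≤i (+ k) _ = 0≤+ k

0≤∣i∣-i : ∀ i → 0ℤ ≤ + ∣ i ∣ - i
0≤∣i∣-i (+ k) = 0≤+ 0 by sym (ℤP.+-inverseʳ (+ k))
0≤∣i∣-i -[1+ k ] = 0≤+ (suc k ℕ.+ suc k)

0≤∣i∣+i : ∀ i → 0ℤ ≤ + ∣ i ∣ + i
0≤∣i∣+i (+ k) = 0≤+ (k ℕ.+ k)
0≤∣i∣+i -[1+ k ] = 0≤+ 0 by sym (ℤP.n⊖n≡0 (suc k))

∧-true-elim : ∀ a {b} → a ∧ b ≡ true → a ≡ true × b ≡ true
∧-true-elim true {true} _ = refl , refl

∧-true-intro : ∀ {a b} → a ≡ true → b ≡ true → a ∧ b ≡ true
∧-true-intro refl refl = refl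

∨-true-elim : ∀ a {b} → a ∨ b ≡ true → a ≡ true ⊎ b ≡ true
∨-true-elim true  _ = inj₁ refl
∨-true-elim false h = inj₂ h

∨-true-introˡ : ∀ {a} b → a ≡ true → a ∨ b ≡ true
∨-true-introˡ b refl = refl

∨-true-introʳ : ∀ a {b} → b ≡ true → a ∨ b ≡ true
∨-true-introʳ a refl = ∨-zeroʳ a

isYes-≟-true : ∀ {i j} → i ≡ j → ⌊ i ≟ j ⌋ ≡ true
isYes-≟-true {i} {j} i≡j = trans (isYes≗does (i ≟ j)) (dec-true (i ≟ j) i≡j)

Corner : ℤ → ℤ → ℤ → Set
Corner S X Y = 0ℤ ≤ S - X - Y × 0ℤ ≤ S - X + Y × 0ℤ ≤ S + X - Y × 0ℤ ≤ S + X + Y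

Corner-of-abs : ∀ S X Y A B → 0ℤ ≤ S - (A + B) →
  0ℤ ≤ A - X → 0ℤ ≤ A + X → 0ℤ ≤ B - Y → 0ℤ ≤ B + Y → Corner S X Y
Corner-of-abs S X Y A B A+B≤S X≤A -X≤A Y≤B -Y≤B =
    (A+B≤S ⊕ X≤A ⊕ Y≤B by solve (S ∷ X ∷ Y ∷ A ∷ B ∷ []))
  , (A+B≤S ⊕ X≤A ⊕ -Y≤B by solve (S ∷ X ∷ Y ∷ A ∷ B ∷ []))
  , (A+B≤S ⊕ -X≤A ⊕ Y≤B by solve (S ∷ X ∷ Y ∷ A ∷ B ∷ []))
  , (A+B≤S ⊕ -X≤A ⊕ -Y≤B by solve (S ∷ X ∷ Y ∷ A ∷ B ∷ []))

Corner⇒abs-bound : ∀ S X Y A B → A ≡ X ⊎ A ≡ - X → B ≡ Y ⊎ B ≡ - Y →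
  Corner S X Y → 0ℤ ≤ S - (A + B)
Corner⇒abs-bound S X Y _ _ (inj₁ refl) (inj₁ refl) (c , _ , _ , _) = c by solve (S ∷ X ∷ Y ∷ [])
Corner⇒abs-bound S X Y _ _ (inj₁ refl) (inj₂ refl) (_ , c , _ , _) = c by solve (S ∷ X ∷ Y ∷ [])
Corner⇒abs-bound S X Y _ _ (inj₂ refl) (inj₁ refl) (_ , _ , c , _) = c by solve (S ∷ X ∷ Y ∷ [])
Corner⇒abs-bound S X Y _ _ (inj₂ refl) (inj₂ refl) (_ , _ , _ , c) = c by solve (S ∷ X ∷ Y ∷ [])

cornerIn⇔Corner : ∀ n X Y → cornerIn n X Y ≡ true ⇔ Corner (+ suc n) X Y
cornerIn⇔Corner n X Y = mk⇔ to from
  where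
  to : cornerIn n X Y ≡ true → Corner (+ suc n) X Y
  to h = Corner-of-abs (+ suc n) X Y (+ ∣ X ∣) (+ ∣ Y ∣) (ℤP.i≤j⇒0≤j-i (+≤+ ∣X∣+∣Y∣≤1+n))
           (0≤∣i∣-i X) (0≤∣i∣+i X) (0≤∣i∣-i Y) (0≤∣i∣+i Y)
    where
    ∣X∣+∣Y∣≤1+n : ∣ X ∣ ℕ.+ ∣ Y ∣ ℕ.≤ suc n
    ∣X∣+∣Y∣≤1+n = ℕP.≤ᵇ⇒≤ (∣ X ∣ ℕ.+ ∣ Y ∣) (suc n) (Equivalence.from T-≡ h)

  from : Corner (+ suc n) X Y → cornerIn n X Y ≡ true
  from c = Equivalence.to T-≡ (ℕP.≤⇒≤ᵇ (ℤP.drop‿+≤+ (ℤP.0≤i-j⇒j≤i {+ suc n} {+ (∣ X ∣ ℕ.+ ∣ Y ∣)} bound)))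
    where
    bound : 0ℤ ≤ + suc n - + (∣ X ∣ ℕ.+ ∣ Y ∣)
    bound = Corner⇒abs-bound (+ suc n) X Y _ _ (ℤP.+∣i∣≡i⊎+∣i∣≡-i X) (ℤP.+∣i∣≡i⊎+∣i∣≡-i Y) c

SquareIn : ℤ → ℤ → ℤ → Set
SquareIn M i j = 0ℤ ≤ M - 1ℤ - i - j × 0ℤ ≤ M - i + j × 0ℤ ≤ M + i - j × 0ℤ ≤ M + 1ℤ + i + j

Between : ℤ → ℤ → Set
Between i X = 0ℤ ≤ X - i × 0ℤ ≤ i + 1ℤ - X

Between-left : ∀ i → Between i i
Between-left i = (0≤+ 0 by solve (i ∷ [])) , (0≤+ 1 by solve (i ∷ []))

Between-right : ∀ i → Between i (i + 1ℤ)
Between-right i = (0≤+ 1 by solve (i ∷ [])) , (0≤+ 0 by solve (i ∷ []))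

Corner-of-SquareIn : ∀ M i j X Y → SquareIn M i j → Between i X → Between j Y →
  Corner (1ℤ + M) X Y
Corner-of-SquareIn M i j X Y (s₁ , s₂ , s₃ , s₄) (i≤X , X≤i+1) (j≤Y , Y≤j+1) =
    (s₁ ⊕ X≤i+1 ⊕ Y≤j+1 by solve (M ∷ i ∷ j ∷ X ∷ Y ∷ []))
  , (s₂ ⊕ X≤i+1 ⊕ j≤Y by solve (M ∷ i ∷ j ∷ X ∷ Y ∷ []))
  , (s₃ ⊕ i≤X ⊕ Y≤j+1 by solve (M ∷ i ∷ j ∷ X ∷ Y ∷ []))
  , (s₄ ⊕ i≤X ⊕ j≤Y by solve (M ∷ i ∷ j ∷ X ∷ Y ∷ []))

SquareIn-of-Corners : ∀ M i j → Corner (1ℤ + M) i j → Corner (1ℤ + M) (i + 1ℤ) j →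
  Corner (1ℤ + M) i (j + 1ℤ) → Corner (1ℤ + M) (i + 1ℤ) (j + 1ℤ) → SquareIn M i j
SquareIn-of-Corners M i j (_ , _ , _ , c₀₀) (_ , c₁₀ , _ , _) (_ , _ , c₀₁ , _) (c₁₁ , _ , _ , _) =
    (c₁₁ by solve (M ∷ i ∷ j ∷ []))
  , (c₁₀ by solve (M ∷ i ∷ j ∷ []))
  , (c₀₁ by solve (M ∷ i ∷ j ∷ []))
  , (c₀₀ by solve (M ∷ i ∷ j ∷ []))

inAD⇔SquareIn : ∀ n i j → inAD n (i , j) ≡ true ⇔ SquareIn (+ n) i j
inAD⇔SquareIn n i j = mk⇔ to from
  where
  corner : ∀ X Y → cornerIn n X Y ≡ true ⇔ Corner (1ℤ + + n) X Y
  corner = cornerIn⇔Corner n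

  to : inAD n (i , j) ≡ true → SquareIn (+ n) i j
  to h =
    let h₀₀ , h₁ = ∧-true-elim (cornerIn n i j) h
        h₁₀ , h₂ = ∧-true-elim (cornerIn n (i + 1ℤ) j) h₁
        h₀₁ , h₁₁ = ∧-true-elim (cornerIn n i (j + 1ℤ)) h₂
    in SquareIn-of-Corners (+ n) i j
         (Equivalence.to (corner i j) h₀₀) (Equivalence.to (corner (i + 1ℤ) j) h₁₀)
         (Equivalence.to (corner i (j + 1ℤ)) h₀₁) (Equivalence.to (corner (i + 1ℤ) (j + 1ℤ)) h₁₁)

  from : SquareIn (+ n) i j → inAD n (i , j) ≡ true
  from s = ∧-true-intro (at (Between-left i) (Between-left j))
          (∧-true-intro (at (Between-right i) (Between-left j))
          (∧-true-intro (at (Between-left i) (Between-right j)) (at (Between-right i) (Between-right j))))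
    where
    at : ∀ {X Y} → Between i X → Between j Y → cornerIn n X Y ≡ true
    at {X} {Y} i≤X≤i+1 j≤Y≤j+1 =
      Equivalence.from (corner X Y) (Corner-of-SquareIn (+ n) i j X Y s i≤X≤i+1 j≤Y≤j+1)

black-sq : ∀ n u → black n (sq n u) ≡ true
black-sq n (x , y) =
  trans (cong (λ k → k ℕ.% 2 ℕ.≡ᵇ 0) ∣i+j+1+n∣≡∣y∣*2) (cong (ℕ._≡ᵇ 0) (ℕD.m*n%n≡0 ∣ y ∣ 2))
  where
  i+j+1+n≡y*2 : ∀ M → (x + y - 1ℤ) + (y - x - M) + (1ℤ + M) ≡ y * + 2
  i+j+1+n≡y*2 M = solve (M ∷ x ∷ y ∷ [])

  ∣i+j+1+n∣≡∣y∣*2 : ∣ (x + y - 1ℤ) + (y - x - + n) + + suc n ∣ ≡ ∣ y ∣ ℕ.* 2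
  ∣i+j+1+n∣≡∣y∣*2 = trans (cong ∣_∣ (i+j+1+n≡y*2 (+ n))) (ℤP.abs-* y (+ 2))

Region : ℤ → Pt → Set
Region M (x , y) = 0ℤ ≤ y × 0ℤ ≤ x + M - 1ℤ × 0ℤ ≤ - x × 0ℤ ≤ 1ℤ - x - y

Region⇔SquareIn : ∀ M x y →
  Region M (x , y) ⇔ (SquareIn M (x + y - 1ℤ) (y - x - M) × x + y - 1ℤ ≤ 0ℤ)
Region⇔SquareIn M x y = mk⇔ to from
  where
  to : Region M (x , y) → SquareIn M (x + y - 1ℤ) (y - x - M) × x + y - 1ℤ ≤ 0ℤ
  to (r₁ , r₂ , r₃ , r₄) =
    ( (r₄ ⊕ r₂ ⊕ r₄ ⊕ r₂ by solve (M ∷ x ∷ y ∷ []))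
    , (r₃ ⊕ r₃ ⊕ 0≤+ 1 by solve (M ∷ x ∷ y ∷ []))
    , (r₂ ⊕ r₂ ⊕ 0≤+ 1 by solve (M ∷ x ∷ y ∷ []))
    , (r₁ ⊕ r₁ by solve (M ∷ x ∷ y ∷ [])) )
    , ℤP.0≤i-j⇒j≤i (r₄ by solve (x ∷ y ∷ []))

  from : SquareIn M (x + y - 1ℤ) (y - x - M) × x + y - 1ℤ ≤ 0ℤ → Region M (x , y)
  from ((_ , s₂ , s₃ , s₄) , left) =
      0≤i+i⇒0≤i y (s₄ by solve (M ∷ x ∷ y ∷ []))
    , 0≤i+i+1⇒0≤i (x + M - 1ℤ) (s₃ by solve (M ∷ x ∷ y ∷ []))
    , 0≤i+i+1⇒0≤i (- x) (s₂ by solve (M ∷ x ∷ y ∷ []))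
    , (ℤP.i≤j⇒0≤j-i left by solve (x ∷ y ∷ []))

InDS⇒Region : ∀ n u → InDS n u → Region (+ n) u
InDS⇒Region n u@(x , y) h =
  let vertex , left = ∧-true-elim (isVertexAD n u) h
      inside , _ = ∧-true-elim (inAD n (sq n u)) vertex
  in Equivalence.from (Region⇔SquareIn (+ n) x y)
       (Equivalence.to (inAD⇔SquareIn n _ _) inside , ℤP.≤ᵇ⇒≤ (Equivalence.from T-≡ left))

Region⇒InDS : ∀ n u → Region (+ n) u → InDS n u
Region⇒InDS n u@(x , y) r =
  let s , left = Equivalence.to (Region⇔SquareIn (+ n) x y) r
  in ∧-true-intro (∧-true-intro (Equivalence.from (inAD⇔SquareIn n _ _) s) (black-sq n u))
                  (Equivalence.to T-≡ (ℤP.≤⇒≤ᵇ left))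

offset : Pt → Pt → Pt
offset (x , y) (x′ , y′) = (x′ - x , y′ - y)

InQuadrant : Pt → Set
InQuadrant (a , b) = 0ℤ ≤ a × 0ℤ ≤ b

infix 4 _≼_

_≼_ : Pt → Pt → Set
(x , y) ≼ (x′ , y′) = 0ℤ ≤ x′ - x × 0ℤ ≤ y′ - y

≼-move : ∀ s u → u ≼ move s u
≼-move se (x , y) = ℤP.i≤j⇒0≤j-i (ℤP.i≤i+j x 1ℤ) , ℤP.i≤j⇒0≤j-i (ℤP.≤-refl {y})
≼-move ne (x , y) = ℤP.i≤j⇒0≤j-i (ℤP.≤-refl {x}) , ℤP.i≤j⇒0≤j-i (ℤP.i≤i+j y 1ℤ)
≼-move e  (x , y) = ℤP.i≤j⇒0≤j-i (ℤP.i≤i+j x 1ℤ) , ℤP.i≤j⇒0≤j-i (ℤP.i≤i+j y 1ℤ)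

Region-convex : ∀ M u w v → Region M u → Region M v → u ≼ w → w ≼ v → Region M w
Region-convex M (x , y) (x′ , y′) (x″ , y″) (r₁ , r₂ , _ , _) (_ , _ , r₃ , r₄)
              (dx , dy) (dx′ , dy′) =
    (r₁ ⊕ dy by solve (y ∷ y′ ∷ []))
  , (r₂ ⊕ dx by solve (M ∷ x ∷ x′ ∷ []))
  , (r₃ ⊕ dx′ by solve (x′ ∷ x″ ∷ []))
  , (r₄ ⊕ dx′ ⊕ dy′ by solve (x′ ∷ y′ ∷ x″ ∷ y″ ∷ []))

SquareIn-below : ∀ M x y → Region M (x , y) → 0ℤ ≤ y - 1ℤ →
  SquareIn M (x + y - 1ℤ) (y - x - M - 1ℤ)
SquareIn-below M x y (_ , r₂ , r₃ , r₄) 1≤y =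
    (r₄ ⊕ r₂ ⊕ r₄ ⊕ r₂ ⊕ 0≤+ 1 by solve (M ∷ x ∷ y ∷ []))
  , (r₃ ⊕ r₃ by solve (M ∷ x ∷ y ∷ []))
  , (r₂ ⊕ r₂ ⊕ 0≤+ 2 by solve (M ∷ x ∷ y ∷ []))
  , (1≤y ⊕ 1≤y ⊕ 0≤+ 1 by solve (M ∷ x ∷ y ∷ []))

SquareIn-above : ∀ M x y → Region M (x , y) → Region M (x , y + 1ℤ) →
  SquareIn M (x + y - 1ℤ) (y - x - M + 1ℤ)
SquareIn-above M x y (r₁ , r₂ , r₃ , _) (_ , _ , _ , r₄′) =
    (r₄′ ⊕ r₂ ⊕ r₄′ ⊕ r₂ ⊕ 0≤+ 1 by solve (M ∷ x ∷ y ∷ []))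
  , (r₃ ⊕ r₃ ⊕ 0≤+ 2 by solve (M ∷ x ∷ y ∷ []))
  , (r₂ ⊕ r₂ by solve (M ∷ x ∷ y ∷ []))
  , (r₁ ⊕ r₁ ⊕ 0≤+ 1 by solve (M ∷ x ∷ y ∷ []))

SquareIn-right : ∀ M x y → Region M (x , y) → Region M (x + 1ℤ , y + 1ℤ) →
  SquareIn M (x + y - 1ℤ + 1ℤ) (y - x - M)
SquareIn-right M x y (r₁ , r₂ , r₃ , _) (_ , _ , _ , r₄′) =
    (r₄′ ⊕ r₂ ⊕ r₄′ ⊕ r₂ ⊕ 0≤+ 3 by solve (M ∷ x ∷ y ∷ []))
  , (r₃ ⊕ r₃ by solve (M ∷ x ∷ y ∷ []))
  , (r₂ ⊕ r₂ ⊕ 0≤+ 2 by solve (M ∷ x ∷ y ∷ []))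
  , (r₁ ⊕ r₁ ⊕ 0≤+ 1 by solve (M ∷ x ∷ y ∷ []))

onSW-on-axis : ∀ n x → onSW n (x , 0ℤ) ≡ true
onSW-on-axis n x = isYes-≟-true (on-axis (+ n))
  where
  on-axis : ∀ M → (x + 0ℤ - 1ℤ) + (0ℤ - x - M) ≡ - (1ℤ + M)
  on-axis M = solve (M ∷ x ∷ [])

edgeDS-within-Region : ∀ n s u → Region (+ n) u → Region (+ n) (move s u) →
  inAD n (crossed s (sq n u)) ≡ true → edgeDS n s u ≡ true
edgeDS-within-Region n s u r r′ crossed∈ =
  ∧-true-intro (Region⇒InDS n u r) (∧-true-intro (Region⇒InDS n (move s u) r′) crossed∈)

edge-within-Region : ∀ n s u → Region (+ n) u → Region (+ n) (move s u) → edge n s u ≡ true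
edge-within-Region n se (x , + zero) r r′ =
  ∨-true-introʳ (edgeDS n se (x , 0ℤ))
    (∧-true-intro (Region⇒InDS n _ r) (∧-true-intro (Region⇒InDS n _ r′)
      (∧-true-intro (onSW-on-axis n x) (onSW-on-axis n (x + 1ℤ)))))
edge-within-Region n se (x , y@(+ suc k)) r r′ =
  ∨-true-introˡ (extraSW n se (x , y)) (edgeDS-within-Region n se (x , y) r r′
    (Equivalence.from (inAD⇔SquareIn n _ _) (SquareIn-below (+ n) x y r (0≤+ k))))
edge-within-Region n se (x , -[1+ k ]) (() , _) _
edge-within-Region n ne (x , y) r r′ =
  ∨-true-introˡ false (edgeDS-within-Region n ne (x , y) r r′
    (Equivalence.from (inAD⇔SquareIn n _ _) (SquareIn-above (+ n) x y r r′)))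
edge-within-Region n e (x , y) r r′ =
  ∨-true-introˡ false (edgeDS-within-Region n e (x , y) r r′
    (Equivalence.from (inAD⇔SquareIn n _ _) (SquareIn-right (+ n) x y r r′)))

edge⇒InDS-move : ∀ n s u → edge n s u ≡ true → InDS n (move s u)
edge⇒InDS-move n s u h with ∨-true-elim (edgeDS n s u) h
... | inj₁ h′ = proj₁ (∧-true-elim (isDS n (move s u)) (proj₂ (∧-true-elim (isDS n u) h′)))
edge⇒InDS-move n se u h | inj₂ h′ =
  proj₁ (∧-true-elim (isDS n (move se u)) (proj₂ (∧-true-elim (isDS n u) h′)))
edge⇒InDS-move n ne u h | inj₂ ()
edge⇒InDS-move n e  u h | inj₂ ()

origin : Pt
origin = (0ℤ , 0ℤ)

indicator : Bool → ℕ
indicator b = if b then 1 else 0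

retreat : Step → Pt → Pt
retreat se (a , b) = (a - 1ℤ , b)
retreat ne (a , b) = (a , b - 1ℤ)
retreat e  (a , b) = (a - 1ℤ , b - 1ℤ)

delannoy : ℕ → Pt → ℕ
delannoy zero    d = indicator (d == origin)
delannoy (suc k) d = indicator (d == origin) ℕ.+ sum (map (λ s → delannoy k (retreat s d)) steps)

InQuadrant-retreat : ∀ s d → InQuadrant (retreat s d) → InQuadrant d
InQuadrant-retreat se (a , b) (p , q) = 0≤i-1⇒0≤i a p , q
InQuadrant-retreat ne (a , b) (p , q) = p , 0≤i-1⇒0≤i b q
InQuadrant-retreat e  (a , b) (p , q) = 0≤i-1⇒0≤i a p , 0≤i-1⇒0≤i b q

==-origin-outside : ∀ d → ¬ InQuadrant d → (d == origin) ≡ false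
==-origin-outside (a , b) out with a ≟ 0ℤ | b ≟ 0ℤ
... | yes refl | yes refl = contradiction (ℤP.≤-refl , ℤP.≤-refl) out
... | yes _    | no _     = refl
... | no _     | _        = refl

delannoy-outside : ∀ k d → ¬ InQuadrant d → delannoy k d ≡ 0
delannoy-outside zero    d out = cong indicator (==-origin-outside d out)
delannoy-outside (suc k) d out =
  cong₂ ℕ._+_ (cong indicator (==-origin-outside d out))
    (cong sum (map-cong (λ s → delannoy-outside k (retreat s d) (out ∘ InQuadrant-retreat s d)) steps))

isYes-≟-offset : ∀ i j → ⌊ i ≟ j ⌋ ≡ ⌊ j - i ≟ 0ℤ ⌋
isYes-≟-offset i j = begin
  ⌊ i ≟ j ⌋          ≡⟨ isYes≗does (i ≟ j) ⟩
  does (i ≟ j)       ≡⟨ does-⇔ i≡j⇔j-i≡0 (i ≟ j) (j - i ≟ 0ℤ) ⟩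
  does (j - i ≟ 0ℤ)  ≡⟨ isYes≗does (j - i ≟ 0ℤ) ⟨
  ⌊ j - i ≟ 0ℤ ⌋     ∎
  where
  open ≡-Reasoning
  i≡j⇔j-i≡0 : i ≡ j ⇔ j - i ≡ 0ℤ
  i≡j⇔j-i≡0 = mk⇔ (ℤP.i≡j⇒i-j≡0 ∘ sym) (sym ∘ ℤP.i-j≡0⇒i≡j j i)

==-offset : ∀ u v → (u == v) ≡ (offset u v == origin)
==-offset (x , y) (x′ , y′) = cong₂ _∧_ (isYes-≟-offset x x′) (isYes-≟-offset y y′)

offset-move : ∀ s u v → offset (move s u) v ≡ retreat s (offset u v)
offset-move se (x , y) (x′ , y′) = cong₂ _,_ (j-[i+1]≡j-i-1 x x′) refl
offset-move ne (x , y) (x′ , y′) = cong₂ _,_ refl (j-[i+1]≡j-i-1 y y′)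
offset-move e  (x , y) (x′ , y′) = cong₂ _,_ (j-[i+1]≡j-i-1 x x′) (j-[i+1]≡j-i-1 y y′)

countPaths≡delannoy : ∀ n k u v → Region (+ n) u → Region (+ n) v →
  countPaths n k u v ≡ delannoy k (offset u v)
countPaths≡delannoy n zero    u v _ _ = cong indicator (==-offset u v)
countPaths≡delannoy n (suc k) u v u∈ v∈ =
  cong₂ ℕ._+_ (cong indicator (==-offset u v)) (cong sum (map-cong first-step steps))
  where
  first-step : ∀ s →
    (if edge n s u then countPaths n k (move s u) v else 0) ≡ delannoy k (retreat s (offset u v))
  first-step s with edge n s u in edge-s
  ... | true  = trans (countPaths≡delannoy n k (move s u) v su∈ v∈) (cong (delannoy k) (offset-move s u v))
    where
    su∈ : Region (+ n) (move s u)
    su∈ = InDS⇒Region n (move s u) (edge⇒InDS-move n s u edge-s)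
  ... | false = sym (trans (cong (delannoy k) (sym (offset-move s u v))) (delannoy-outside k _ beyond-v))
    where
    beyond-v : ¬ (move s u ≼ v)
    beyond-v su≼v with () ← trans (sym edge-s)
      (edge-within-Region n s u u∈ (Region-convex (+ n) u (move s u) v u∈ v∈ (≼-move s u) su≼v))

Region-vOdd : ∀ n m → suc m ℕ.≤ n → Region (+ n) (vOdd (suc m))
Region-vOdd n m m<n = vOdd∈ (+ n) (+ m) (0≤+ m) (ℤP.i≤j⇒0≤j-i (+≤+ m<n))
  where
  vOdd∈ : ∀ N M → 0ℤ ≤ M → 0ℤ ≤ N - (1ℤ + M) → Region N (- (1ℤ + M - 1ℤ) , 1ℤ + M - 1ℤ)
  vOdd∈ N M 0≤M M<N =
      (0≤M by solve (M ∷ [])) , (M<N by solve (N ∷ M ∷ []))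
    , (0≤M by solve (M ∷ [])) , (0≤+ 1 by solve (M ∷ []))

Region-vEven : ∀ n m → suc m ℕ.≤ n → Region (+ n) (vEven (suc m))
Region-vEven n m m<n = vEven∈ (+ n) (+ m) (0≤+ m) (ℤP.i≤j⇒0≤j-i (+≤+ m<n))
  where
  vEven∈ : ∀ N M → 0ℤ ≤ M → 0ℤ ≤ N - (1ℤ + M) → Region N (1ℤ - (1ℤ + M) , 1ℤ + M)
  vEven∈ N M 0≤M M<N =
      (0≤+ 1 ⊕ 0≤M) , (M<N by solve (N ∷ M ∷ []))
    , (0≤M by solve (M ∷ [])) , (0≤+ 0 by solve (M ∷ []))

delannoyDet : ℕ → Pt → Pt → Pt → Pt → ℤ
delannoyDet k a b v w =
  + delannoy k (offset a v) * + delannoy k (offset b w) - + delannoy k (offset a w) * + delannoy k (offset b v)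

det2≡delannoyDet : ∀ n a b → Region (+ n) a → Region (+ n) b →
  ∀ {m} → 1 ℕ.≤ m → m ℕ.≤ n → det2 n a b m ≡ delannoyDet (2 ℕ.* n) a b (vOdd m) (vEven m)
det2≡delannoyDet n a b a∈ b∈ {suc m} (s≤s _) m<n =
  cong₂ _-_ (cong₂ _*_ (paths a∈ v∈) (paths b∈ w∈)) (cong₂ _*_ (paths a∈ w∈) (paths b∈ v∈))
  where
  paths : ∀ {u v} → Region (+ n) u → Region (+ n) v → + N n u v ≡ + delannoy (2 ℕ.* n) (offset u v)
  paths {u} {v} u∈ v∈ = cong +_ (countPaths≡delannoy n (2 ℕ.* n) u v u∈ v∈)
  v∈ : Region (+ n) (vOdd (suc m))
  v∈ = Region-vOdd n m m<n
  w∈ : Region (+ n) (vEven (suc m))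
  w∈ = Region-vEven n m m<n

shift : Pt → Pt
shift (x , y) = (x + 1ℤ , y - 1ℤ)

offset-shift : ∀ u v → offset (shift u) (shift v) ≡ offset u v
offset-shift (x , y) (x′ , y′) = cong₂ _,_ ([j+k]-[i+k]≡j-i x x′ 1ℤ) ([j+k]-[i+k]≡j-i y y′ -1ℤ)

delannoyDet-shift : ∀ k a b v w →
  delannoyDet k (shift a) (shift b) (shift v) (shift w) ≡ delannoyDet k a b v w
delannoyDet-shift k a b v w
  rewrite offset-shift a v | offset-shift a w | offset-shift b v | offset-shift b w = refl

shift-vOdd : ∀ m → shift (vOdd (suc m)) ≡ vOdd m
shift-vOdd m = cong₂ _,_ (x-shift (+ m)) (y-shift (+ m))
  where
  x-shift : ∀ M → - (1ℤ + M - 1ℤ) + 1ℤ ≡ - (M - 1ℤ)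
  x-shift M = solve (M ∷ [])
  y-shift : ∀ M → 1ℤ + M - 1ℤ - 1ℤ ≡ M - 1ℤ
  y-shift M = solve (M ∷ [])

shift-vEven : ∀ m → shift (vEven (suc m)) ≡ vEven m
shift-vEven m = cong₂ _,_ (x-shift (+ m)) (y-shift (+ m))
  where
  x-shift : ∀ M → 1ℤ - (1ℤ + M) + 1ℤ ≡ 1ℤ - M
  x-shift M = solve (M ∷ [])
  y-shift : ∀ M → 1ℤ + M - 1ℤ ≡ M
  y-shift M = solve (M ∷ [])

delannoyDet-unreachable : ∀ k a b v w → ¬ (a ≼ v) → ¬ (b ≼ v) → delannoyDet k a b v w ≡ 0ℤ
delannoyDet-unreachable k a b v w a⋠v b⋠v
  rewrite delannoy-outside k (offset a v) a⋠v | delannoy-outside k (offset b v) b⋠v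
        | ℤP.*-zeroʳ (+ delannoy k (offset a w)) = refl

⋠-vOdd-1 : ∀ x y → 0ℤ ≤ y - 1ℤ → ¬ ((x , y) ≼ vOdd 1)
⋠-vOdd-1 x y 1≤y (_ , y≤0) = 0≰-1 (1≤y ⊕ y≤0 by solve (y ∷ []))

⋠-vOdd-beyond : ∀ n x y → 0ℤ ≤ x + + n - 1ℤ → ¬ ((x , y) ≼ vOdd (suc n))
⋠-vOdd-beyond n x y 1-n≤x (x≤-n , _) = 0≰-1 (sum≡-1 (+ n) 1-n≤x x≤-n)
  where
  sum≡-1 : ∀ N → 0ℤ ≤ x + N - 1ℤ → 0ℤ ≤ - (1ℤ + N - 1ℤ) - x → 0ℤ ≤ -1ℤ
  sum≡-1 N p q = p ⊕ q by solve (N ∷ x ∷ [])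

sumTo-cong : ∀ k {f g : ℕ → ℤ} → (∀ {m} → 1 ℕ.≤ m → m ℕ.≤ k → f m ≡ g m) →
  sumTo k f ≡ sumTo k g
sumTo-cong zero    f≗g = refl
sumTo-cong (suc k) f≗g =
  cong₂ _+_ (sumTo-cong k (λ 1≤m m≤k → f≗g 1≤m (ℕP.m≤n⇒m≤1+n m≤k))) (f≗g (s≤s z≤n) ℕP.≤-refl)

sumTo-suc : ∀ k f → sumTo (suc k) f ≡ f 1 + sumTo k (f ∘ suc)
sumTo-suc zero    f = ℤP.+-comm 0ℤ (f 1)
sumTo-suc (suc k) f = trans (cong (_+ f (2 ℕ.+ k)) (sumTo-suc k f)) (ℤP.+-assoc (f 1) _ _)

sumTo-shift : ∀ k f → f 1 ≡ 0ℤ → f (suc k) ≡ 0ℤ → sumTo k f ≡ sumTo k (f ∘ suc)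
sumTo-shift k f f1≡0 fk+1≡0 = begin
  sumTo k f                  ≡⟨ sym (ℤP.+-identityʳ _) ⟩
  sumTo k f + 0ℤ             ≡⟨ cong (λ t → sumTo k f + t) (sym fk+1≡0) ⟩
  sumTo (suc k) f            ≡⟨ sumTo-suc k f ⟩
  f 1 + sumTo k (f ∘ suc)    ≡⟨ cong (_+ sumTo k (f ∘ suc)) f1≡0 ⟩
  0ℤ + sumTo k (f ∘ suc)     ≡⟨ ℤP.+-identityˡ _ ⟩
  sumTo k (f ∘ suc)          ∎
  where open ≡-Reasoning

lemma4p1 : (n : ℕ) (p q ℓ : ℤ) → p ≢ q →
    InDS n (p , ℓ) → InDS n (q , ℓ) →
    InDS n (p + 1ℤ , ℓ - 1ℤ) → InDS n (q + 1ℤ , ℓ - 1ℤ) →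
    QV n (p , ℓ) (q , ℓ) ≡ QV n (p + 1ℤ , ℓ - 1ℤ) (q + 1ℤ , ℓ - 1ℤ)
lemma4p1 n p q ℓ _ a∈ b∈ a′∈ b′∈ = begin
  QV n a b                      ≡⟨ sumTo-cong n (det2≡delannoyDet n a b Ra Rb) ⟩
  sumTo n (D a b)               ≡⟨ sumTo-shift n (D a b) at-v₁ at-v₂ₙ₊₁ ⟩
  sumTo n (D a b ∘ suc)         ≡⟨ sumTo-cong n (λ {m} _ _ → shifted m) ⟩
  sumTo n (D a′ b′)             ≡⟨ sumTo-cong n (det2≡delannoyDet n a′ b′ Ra′ Rb′) ⟨
  QV n a′ b′                    ∎
  where
  open ≡-Reasoning
  a b a′ b′ : Pt
  a = (p , ℓ)
  b = (q , ℓ)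
  a′ = (p + 1ℤ , ℓ - 1ℤ)
  b′ = (q + 1ℤ , ℓ - 1ℤ)
  Ra : Region (+ n) a
  Rb : Region (+ n) b
  Ra′ : Region (+ n) a′
  Rb′ : Region (+ n) b′
  Ra = InDS⇒Region n a a∈
  Rb = InDS⇒Region n b b∈
  Ra′ = InDS⇒Region n a′ a′∈
  Rb′ = InDS⇒Region n b′ b′∈

  K : ℕ
  K = 2 ℕ.* n

  D : Pt → Pt → ℕ → ℤ
  D u v m = delannoyDet K u v (vOdd m) (vEven m)

  at-v₁ : D a b 1 ≡ 0ℤ
  at-v₁ = delannoyDet-unreachable K a b (vOdd 1) (vEven 1)
    (⋠-vOdd-1 p ℓ (proj₁ Ra′)) (⋠-vOdd-1 q ℓ (proj₁ Rb′))

  at-v₂ₙ₊₁ : D a b (suc n) ≡ 0ℤ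
  at-v₂ₙ₊₁ = delannoyDet-unreachable K a b (vOdd (suc n)) (vEven (suc n))
    (⋠-vOdd-beyond n p ℓ (proj₁ (proj₂ Ra))) (⋠-vOdd-beyond n q ℓ (proj₁ (proj₂ Rb)))

  shifted : ∀ m → D a b (suc m) ≡ D a′ b′ m
  shifted m = trans (sym (delannoyDet-shift K a b (vOdd (suc m)) (vEven (suc m))))
                    (cong₂ (delannoyDet K a′ b′) (shift-vOdd m) (shift-vEven m))
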